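{- Let $M_1=(Q_1,R_1,X,\delta_1)$ and $M_2=(Q_2,R_2,X,\delta_2)$ be rough finite state machines with the same input monoid $X$. Then $M_1\wedge M_2\preceq M_1\times M_2$, i.e. the restricted direct product of $M_1$ and $M_2$ is covered by their full direct product.
   Context: For an equivalence relation $R$ on a set $Q$ and $A\subseteq Q$: $\underline{A}=\bigcup\{[q]:[q]\subseteq A\}$, $\overline{A}=\bigcup\{[q]:[q]\cap A\ne\emptyset\}$; a rough set in $(Q,R)$ is a pair $(\underline{A},\overline{A})$ with $A\subseteq Q$. A rough finite state machine (RFSM) is $M=(Q,R,X,\delta)$ with $Q$ nonempty finite, $R$ an equivalence relation on $Q$, $X$ a monoid, and $\delta$ assigning to each $(q,x)\in Q\times X$ a rough set $\delta(q,x)=(\underline{\delta(q,x)},\overline{\delta(q,x)})$ in $(Q,R)$. Covering: for RFSMs $M_1=(Q_1,R_1,X_1,\delta_1)$, $M_2=(Q_2,R_2,X_2,\delta_2)$, $M_1\preceq M_2$ means there exist a surjection $\eta:Q_2\to Q_1$ and a monoid homomorphism $\xi:X_1\to X_2$ (so $\xi(e_1)=e_2$ and $\xi$ is multiplicative) such that $(p,q)\in R_2\Rightarrow(\eta(p),\eta(q))\in R_1$ for all $p,q\in Q_2$, and for all $q\in Q_2$, $x\in X_1$: $\underline{\delta_1(\eta(q),x)}\subseteq\eta(\underline{\delta_2(q,\xi(x))})$ and $\overline{\delta_1(\eta(q),x)}\subseteq\eta(\overline{\delta_2(q,\xi(x))})$. $R_1\times R_2$ is the equivalence on $Q_1\times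 Q_2$ with $((p_1,p_2),(q_1,q_2))\in R_1\times R_2$ iff $(p_1,q_1)\in R_1$ and $(p_2,q_2)\in R_2$. Full direct product: for RFSMs $M_i=(Q_i,R_i,X_i,\delta_i)$, $M_1\times M_2=(Q_1\times Q_2,R_1\times R_2,X_1\times X_2,\delta_1\times\delta_2)$ with $X_1\times X_2$ the product monoid and $(\delta_1\times\delta_2)((q_1,q_2),(x_1,x_2))=(\underline{\delta_1(q_1,x_1)}\times\underline{\delta_2(q_2,x_2)},\ \overline{\delta_1(q_1,x_1)}\times\overline{\delta_2(q_2,x_2)})$. Restricted direct product (common input monoid $X$): $M_1\wedge M_2=(Q_1\times Q_2,R_1\times R_2,X,\delta_1\wedge\delta_2)$ with $(\delta_1\wedge\delta_2)((q_1,q_2),x)=(\underline{\delta_1(q_1,x)}\times\underline{\delta_2(q_2,x)},\ \overline{\delta_1(q_1,x)}\times\overline{\delta_2(q_2,x)})$. -}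

module Defs where

open import Level using (Level; 0ℓ; _⊔_) renaming (suc to lsuc)
open import Data.Nat using (ℕ)
open import Data.Fin using (Fin)
open import Data.Fin.Properties using (*↔×)
open import Data.Nat using (_*_)
open import Function.Construct.Composition using (_↔-∘_)
open import Function.Construct.Symmetry using (↔-sym)
open import Data.Product.Function.NonDependent.Propositional using (_×-↔_)
open import Data.Product using (Σ; ∃; _×_; _,_; proj₁; proj₂)
open import Function.Bundles using (_↔_)
open import Relation.Binary.Core using (Rel)
open import Relation.Binary.Structures using (IsEquivalence)
open import Relation.Binary.PropositionalEquality using (_≡_)
open import Relation.Unary using (Pred; _⊆_)
open import Algebra.Bundles using (Monoid)
open import Algebra.Morphism.Structures using (module MonoidMorphisms)
import Algebra.Construct.DirectProduct as DP

Subset : Set → Set₁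
Subset Q = Pred Q 0ℓ

_≐_ : {Q : Set} → Subset Q → Subset Q → Set
A ≐ B = (A ⊆ B) × (B ⊆ A)

module _ {Q : Set} (R : Rel Q 0ℓ) where
  class : Q → Subset Q
  class p r = R p r

  lower : Subset Q → Subset Q
  lower A q = ∃ λ p → (class p ⊆ A) × class p q

  upper : Subset Q → Subset Q
  upper A q = ∃ λ p → (∃ λ r → class p r × A r) × class p q

  IsRoughSet : Subset Q → Subset Q → Set₁
  IsRoughSet L U = ∃ λ (A : Subset Q) → (L ≐ lower A) × (U ≐ upper A)

Finite : Set → Set
Finite Q = ∃ λ n → Q ↔ Fin n

record RFSM {c ℓ : Level} (X : Monoid c ℓ) : Set (lsuc 0ℓ ⊔ c) where
  open Monoid X using (Carrier)
  field
    Q         : Set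
    finite    : Finite Q
    inhabited : Q
    R         : Rel Q 0ℓ
    R-isEquiv : IsEquivalence R
    δL        : Q → Carrier → Subset Q
    δU        : Q → Carrier → Subset Q
    δ-rough   : ∀ q x → IsRoughSet R (δL q x) (δU q x)

image : {A B : Set} → (A → B) → Subset A → Subset B
image η S b = ∃ λ a → S a × (η a ≡ b)

Surjective : {A B : Set} → (A → B) → Set
Surjective {A} {B} η = ∀ (b : B) → ∃ λ (a : A) → η a ≡ b

_⪯_ : ∀ {c₁ ℓ₁ c₂ ℓ₂} {X₁ : Monoid c₁ ℓ₁} {X₂ : Monoid c₂ ℓ₂}
      → RFSM X₁ → RFSM X₂ → Set (c₁ ⊔ ℓ₁ ⊔ c₂ ⊔ ℓ₂)
_⪯_ {X₁ = X₁} {X₂ = X₂} M₁ M₂ =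
  Σ (M₂.Q → M₁.Q) λ η → Σ (Monoid.Carrier X₁ → Monoid.Carrier X₂) λ ξ →
    Surjective η
    × MonoidMorphisms.IsMonoidHomomorphism (Monoid.rawMonoid X₁) (Monoid.rawMonoid X₂) ξ
    × (∀ p q → M₂.R p q → M₁.R (η p) (η q))
    × (∀ q x → M₁.δL (η q) x ⊆ image η (M₂.δL q (ξ x)))
    × (∀ q x → M₁.δU (η q) x ⊆ image η (M₂.δU q (ξ x)))
  where module M₁ = RFSM M₁
        module M₂ = RFSM M₂

_⊠_ : {A B : Set} → Subset A → Subset B → Subset (A × B)
(S ⊠ T) (a , b) = S a × T b

_×R_ : {A B : Set} → Rel A 0ℓ → Rel B 0ℓ → Rel (A × B) 0ℓ
(R₁ ×R R₂) (p₁ , p₂) (q₁ , q₂) = R₁ p₁ q₁ × R₂ p₂ q₂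

finite-× : {A B : Set} → Finite A → Finite B → Finite (A × B)
finite-× (n , f) (m , g) = n * m , ↔-sym (*↔× {n} {m}) ↔-∘ (f ×-↔ g)

module _ {Q₁ Q₂ : Set} (R₁ : Rel Q₁ 0ℓ) (R₂ : Rel Q₂ 0ℓ)
         (E₁ : IsEquivalence R₁) (E₂ : IsEquivalence R₂) where
  private
    module E₁ = IsEquivalence E₁
    module E₂ = IsEquivalence E₂

  lower-⊠ : (A : Subset Q₁) (B : Subset Q₂) →
            lower (R₁ ×R R₂) (A ⊠ B) ≐ (lower R₁ A ⊠ lower R₂ B)
  proj₁ (lower-⊠ A B) {q₁ , q₂} ((p₁ , p₂) , sub , c₁ , c₂) =
      (p₁ , (λ {r} d → proj₁ (sub {r , p₂} (d , E₂.refl))) , c₁)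
    , (p₂ , (λ {r} d → proj₂ (sub {p₁ , r} (E₁.refl , d))) , c₂)
  proj₂ (lower-⊠ A B) {q₁ , q₂} ((p₁ , s₁ , c₁) , (p₂ , s₂ , c₂)) =
    (p₁ , p₂) , (λ {r} d → s₁ (proj₁ d) , s₂ (proj₂ d)) , c₁ , c₂

  upper-⊠ : (A : Subset Q₁) (B : Subset Q₂) →
            upper (R₁ ×R R₂) (A ⊠ B) ≐ (upper R₁ A ⊠ upper R₂ B)
  proj₁ (upper-⊠ A B) {q₁ , q₂} ((p₁ , p₂) , ((r₁ , r₂) , (d₁ , d₂) , a , b) , c₁ , c₂) =
    (p₁ , (r₁ , d₁ , a) , c₁) , (p₂ , (r₂ , d₂ , b) , c₂)
  proj₂ (upper-⊠ A B) {q₁ , q₂} ((p₁ , (r₁ , d₁ , a) , c₁) , (p₂ , (r₂ , d₂ , b) , c₂)) =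
    (p₁ , p₂) , ((r₁ , r₂) , (d₁ , d₂) , a , b) , c₁ , c₂

  ×R-isEquiv : IsEquivalence (R₁ ×R R₂)
  ×R-isEquiv = record
    { refl  = E₁.refl , E₂.refl
    ; sym   = λ (a , b) → E₁.sym a , E₂.sym b
    ; trans = λ (a , b) (c , d) → E₁.trans a c , E₂.trans b d }

  ⊠-rough : ∀ {L₁ U₁ L₂ U₂} → IsRoughSet R₁ L₁ U₁ → IsRoughSet R₂ L₂ U₂ →
            IsRoughSet (R₁ ×R R₂) (L₁ ⊠ L₂) (U₁ ⊠ U₂)
  ⊠-rough (A , (l₁ , l₁′) , (u₁ , u₁′)) (B , (l₂ , l₂′) , (u₂ , u₂′)) =
      (A ⊠ B)
    , ((λ (x , y) → proj₂ (lower-⊠ A B) (l₁ x , l₂ y))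
      , (λ z → let (x , y) = proj₁ (lower-⊠ A B) z in l₁′ x , l₂′ y))
    , ((λ (x , y) → proj₂ (upper-⊠ A B) (u₁ x , u₂ y))
      , (λ z → let (x , y) = proj₁ (upper-⊠ A B) z in u₁′ x , u₂′ y))

_×M_ : ∀ {c₁ ℓ₁ c₂ ℓ₂} {X₁ : Monoid c₁ ℓ₁} {X₂ : Monoid c₂ ℓ₂}
       → RFSM X₁ → RFSM X₂ → RFSM (DP.monoid X₁ X₂)
M₁ ×M M₂ = record
  { Q         = M₁.Q × M₂.Q
  ; finite    = finite-× M₁.finite M₂.finite
  ; inhabited = M₁.inhabited , M₂.inhabited
  ; R         = M₁.R ×R M₂.R
  ; R-isEquiv = ×R-isEquiv M₁.R M₂.R M₁.R-isEquiv M₂.R-isEquiv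
  ; δL        = λ (q₁ , q₂) (x₁ , x₂) → M₁.δL q₁ x₁ ⊠ M₂.δL q₂ x₂
  ; δU        = λ (q₁ , q₂) (x₁ , x₂) → M₁.δU q₁ x₁ ⊠ M₂.δU q₂ x₂
  ; δ-rough   = λ (q₁ , q₂) (x₁ , x₂) →
      ⊠-rough M₁.R M₂.R M₁.R-isEquiv M₂.R-isEquiv (M₁.δ-rough q₁ x₁) (M₂.δ-rough q₂ x₂)
  }
  where module M₁ = RFSM M₁
        module M₂ = RFSM M₂

_∧M_ : ∀ {c ℓ} {X : Monoid c ℓ} → RFSM X → RFSM X → RFSM X
M₁ ∧M M₂ = record
  { Q         = M₁.Q × M₂.Q
  ; finite    = finite-× M₁.finite M₂.finite
  ; inhabited = M₁.inhabited , M₂.inhabited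
  ; R         = M₁.R ×R M₂.R
  ; R-isEquiv = ×R-isEquiv M₁.R M₂.R M₁.R-isEquiv M₂.R-isEquiv
  ; δL        = λ (q₁ , q₂) x → M₁.δL q₁ x ⊠ M₂.δL q₂ x
  ; δU        = λ (q₁ , q₂) x → M₁.δU q₁ x ⊠ M₂.δU q₂ x
  ; δ-rough   = λ (q₁ , q₂) x →
      ⊠-rough M₁.R M₂.R M₁.R-isEquiv M₂.R-isEquiv (M₁.δ-rough q₁ x) (M₂.δ-rough q₂ x)
  }
  where module M₁ = RFSM M₁
        module M₂ = RFSM M₂

module Submission where

open import Defs
open import Algebra.Bundles using (Monoid)
open import Algebra.Morphism.Structures using (module MonoidMorphisms)
import Algebra.Construct.DirectProduct as DP
open import Data.Product using (_×_; _,_)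
open import Function using (id)
open import Relation.Binary.PropositionalEquality using () renaming (refl to ≡-refl)
open import Relation.Unary using (_⊆_)

-- The full product, fed the diagonal input (x , x), runs exactly as the
-- restricted product on x; so identity on states and the diagonal on inputs
-- exhibit the covering, every transition condition holding on the nose.

module _ {c ℓ} (X : Monoid c ℓ) where
  open Monoid X using (Carrier; rawMonoid; refl)
  open MonoidMorphisms rawMonoid (Monoid.rawMonoid (DP.monoid X X))

  diagonal : Carrier → Carrier × Carrier
  diagonal x = x , x

  diagonal-isMonoidHomomorphism : IsMonoidHomomorphism diagonal
  diagonal-isMonoidHomomorphism = record
    { isMagmaHomomorphism = record
        { isRelHomomorphism = record { cong = λ x≈y → x≈y , x≈y }
        ; homo              = λ _ _ → refl , refl
        }
    ; ε-homo = refl , refl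
    }

id-surjective : {A : Set} → Surjective (id {A = A})
id-surjective a = a , ≡-refl

⊆-image-id : {A : Set} (S : Subset A) → S ⊆ image id S
⊆-image-id S {a} a∈S = a , a∈S , ≡-refl

proposition3p1 : ∀ {c ℓ} {X : Monoid c ℓ} (M₁ M₂ : RFSM X) → (M₁ ∧M M₂) ⪯ (M₁ ×M M₂)
proposition3p1 {X = X} M₁ M₂ =
    id , diagonal X
  , id-surjective
  , diagonal-isMonoidHomomorphism X
  , (λ _ _ pRq → pRq)
  , (λ q x → ⊆-image-id (RFSM.δL (M₁ ∧M M₂) q x))
  , (λ q x → ⊆-image-id (RFSM.δU (M₁ ∧M M₂) q x))
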